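{- Let $n\geq 2$ and $m$ be integers with $1\leq m\leq\binom{n}{2}$, let $r>2$ be an integer, and let $G$ be any graph with $n$ vertices and $m$ edges. Let $k$ be the smallest element of $\{1,\ldots,n-1\}$ with $m\leq \frac{k(2n-k-1)}{2}$ (equivalently $k=\left\lceil n-\frac12-\sqrt{\frac14+n^2-n-2m}\right\rceil$), and let $p_k=m-\frac{(k-1)(2n-k)}{2}$. If $i_r$ denotes the number of independent sets of size $r$ in $G$, then $$i_r\leq \binom{n-k-p_k}{r-1}+\binom{n-k}{r},$$ and this bound is sharp, i.e. for each such $n,m,r$ there is a graph with $n$ vertices and $m$ edges attaining equality.
   Context: All graphs are finite and simple. An independent set of size $r$ is a set of $r$ pairwise non-adjacent vertices. -}

module Defs where

open import Data.Nat using (ℕ; zero; suc; _+_; _*_)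
open import Data.Bool using (Bool; true; false; _∧_; if_then_else_; not)
open import Data.Fin using (Fin; toℕ)
open import Data.Nat using (_<ᵇ_)
open import Data.List using (List; []; _∷_; map; _++_; allFin)
open import Data.Nat.ListAction using (sum)
open import Data.Vec using (Vec; []; _∷_; lookup)
open import Relation.Binary.PropositionalEquality using (_≡_)

record Graph (n : ℕ) : Set where
  field
    adj    : Fin n → Fin n → Bool
    sym    : ∀ i j → adj i j ≡ adj j i
    irrefl : ∀ i → adj i i ≡ false
open Graph public

[_] : Bool → ℕ
[ true ]  = 1
[ false ] = 0

edges : ∀ {n} → Graph n → ℕ
edges {n} G =
  sum (map (λ i → sum (map (λ j → [ (toℕ i <ᵇ toℕ j) ∧ adj G i j ]) (allFin n))) (allFin n))

-- all subsets of Fin n, as characteristic vectors (each listed exactly once)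
allSubsets : (n : ℕ) → List (Vec Bool n)
allSubsets zero    = [] ∷ []
allSubsets (suc n) = map (true ∷_) (allSubsets n) ++ map (false ∷_) (allSubsets n)

size : ∀ {n} → Vec Bool n → ℕ
size []       = 0
size (b ∷ bs) = [ b ] + size bs

andL : List Bool → Bool
andL []       = true
andL (b ∷ bs) = b ∧ andL bs

isIndependent : ∀ {n} → Graph n → Vec Bool n → Bool
isIndependent {n} G S =
  andL (map (λ i → andL (map (λ j →
    not (lookup S i ∧ lookup S j ∧ adj G i j)) (allFin n))) (allFin n))

_==_ : ℕ → ℕ → Bool
zero  == zero  = true
zero  == suc _ = false
suc _ == zero  = false
suc m == suc n = m == n

indepCount : ∀ {n} → Graph n → ℕ → ℕ
indepCount {n} G r =
  sum (map (λ S → [ (size S == r) ∧ isIndependent G S ]) (allSubsets n))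

{-# OPTIONS --safe #-}
module Submission where

-- An independent r-set of G is an r-clique of the complement, which has N = C(n,2) − m edges.
-- Write N = C(s,2) + q with q < s. Deleting a vertex v of minimum co-degree x, the cliques
-- through v lie inside v and its x co-neighbours, so there are at most C(x, r−1) of them;
-- minimality gives C(x+1,2) ≤ N, and convexity of C(·, r−1) shows that C(x, r−1) plus the bound
-- for the remaining N − x co-edges is at most C(q, r−1) + C(s, r). Induction on the vertex set
-- gives i_r ≤ C(q, r−1) + C(s, r). This is attained by joining k−1 vertices to everything and one
-- more vertex to p_k others, and the minimality of k gives s = n − k and q = n − k − p_k.

open import Defs hiding (sym)
open import Data.Nat using (ℕ; zero; suc; _+_; _*_; _∸_; _≤_; _<_; z≤n; s≤s; _<ᵇ_)
open import Data.Nat.Properties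
open import Data.Nat.Combinatorics using (_C_; nCk+nC[k+1]≡[n+1]C[k+1])
open import Data.Nat.ListAction using (sum)
open import Data.Nat.ListAction.Properties using (sum-++)
open import Data.Bool using (Bool; true; false; _∧_; _∨_; not; if_then_else_)
open import Data.Bool.Properties using (∧-zeroʳ; ∧-identityʳ; ∨-comm; ∧-conicalˡ; ∧-conicalʳ)
open import Data.Fin using (Fin; toℕ; fromℕ<) renaming (zero to fzero; suc to fsuc)
open import Data.Fin.Properties using (toℕ-injective; toℕ-fromℕ<)
open import Data.List using (List; []; _∷_; map; _++_; allFin; tabulate)
open import Data.List.Properties using (map-++; map-∘; map-tabulate)
open import Data.Vec using (Vec; []; _∷_; lookup)
open import Data.Product using (_×_; Σ; ∃₂; _,_; proj₁; proj₂)
open import Data.Sum using (_⊎_; inj₁; inj₂)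
open import Data.Empty using (⊥-elim)
open import Relation.Nullary using (yes; no)
open import Relation.Binary using (tri<; tri≈; tri>)
open import Relation.Binary.PropositionalEquality
  using (_≡_; _≢_; refl; sym; trans; cong; cong₂; subst; ≢-sym; module ≡-Reasoning)
open import Function using (_∘_; id)
open import Data.Nat.Tactic.RingSolver using (solve-∀)
open import Algebra.Properties.CommutativeMonoid.Sum +-0-commutativeMonoid
  using (∑-distrib-+; ∑-comm; sum-cong-≗; sum-replicate-zero; sum-syntax)
  renaming (sum to ∑)
open import Algebra.Properties.CommutativeSemigroup +-commutativeSemigroup
  using () renaming (interchange to +-interchange)

[]-mono : ∀ {b c} → (b ≡ true → c ≡ true) → [ b ] ≤ [ c ]
[]-mono {false} _ = z≤n
[]-mono {true} b⇒c rewrite b⇒c refl = ≤-refl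

∧-intro : ∀ {a b} → a ≡ true → b ≡ true → a ∧ b ≡ true
∧-intro refl refl = refl

∧-elim : ∀ a {b} → a ∧ b ≡ true → a ≡ true × b ≡ true
∧-elim true {true} _ = refl , refl

true≢false : true ≢ false
true≢false ()

==-refl : ∀ m → (m == m) ≡ true
==-refl zero    = refl
==-refl (suc m) = ==-refl m

==⇒≡ : ∀ m n → (m == n) ≡ true → m ≡ n
==⇒≡ zero    zero    _ = refl
==⇒≡ (suc m) (suc n) p = cong suc (==⇒≡ m n p)

≢⇒==-false : ∀ {m n} → m ≢ n → (m == n) ≡ false
≢⇒==-false {zero}  {zero}  m≢n = ⊥-elim (m≢n refl)
≢⇒==-false {zero}  {suc n} _   = refl
≢⇒==-false {suc m} {zero}  _   = refl
≢⇒==-false {suc m} {suc n} m≢n = ≢⇒==-false (m≢n ∘ cong suc)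

==-sym : ∀ m n → (m == n) ≡ (n == m)
==-sym zero    zero    = refl
==-sym zero    (suc n) = refl
==-sym (suc m) zero    = refl
==-sym (suc m) (suc n) = ==-sym m n

<⇒<ᵇ≡true : ∀ {m n} → m < n → (m <ᵇ n) ≡ true
<⇒<ᵇ≡true {zero}  {suc n} _         = refl
<⇒<ᵇ≡true {suc m} {suc n} (s≤s m<n) = <⇒<ᵇ≡true m<n

≥⇒<ᵇ≡false : ∀ {m n} → n ≤ m → (m <ᵇ n) ≡ false
≥⇒<ᵇ≡false {m}     {zero}  _         = refl
≥⇒<ᵇ≡false {suc m} {suc n} (s≤s n≤m) = ≥⇒<ᵇ≡false n≤m

<ᵇ≡false⇒≥ : ∀ m n → (m <ᵇ n) ≡ false → n ≤ m
<ᵇ≡false⇒≥ m n eq = ≮⇒≥ (λ m<n → true≢false (trans (sym (<⇒<ᵇ≡true m<n)) eq))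

_=ᵇ_ : ∀ {n} → Fin n → Fin n → Bool
i =ᵇ j = toℕ i == toℕ j

=ᵇ-refl : ∀ {n} (i : Fin n) → (i =ᵇ i) ≡ true
=ᵇ-refl i = ==-refl (toℕ i)

=ᵇ⇒≡ : ∀ {n} (i j : Fin n) → (i =ᵇ j) ≡ true → i ≡ j
=ᵇ⇒≡ i j p = toℕ-injective (==⇒≡ (toℕ i) (toℕ j) p)

=ᵇ-sym : ∀ {n} (i j : Fin n) → (i =ᵇ j) ≡ (j =ᵇ i)
=ᵇ-sym i j = ==-sym (toℕ i) (toℕ j)

∑-mono-≤ : ∀ {n} {f g : Fin n → ℕ} → (∀ i → f i ≤ g i) → ∑ f ≤ ∑ g
∑-mono-≤ {zero}  f≤g = z≤n
∑-mono-≤ {suc n} f≤g = +-mono-≤ (f≤g fzero) (∑-mono-≤ (f≤g ∘ fsuc))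

∑-const : ∀ n c → ∑[ i < n ] c ≡ n * c
∑-const zero    c = refl
∑-const (suc n) c = cong (c +_) (∑-const n c)

∑-*ʳ : ∀ {n} (f : Fin n → ℕ) c → ∑[ i < n ] (f i * c) ≡ ∑ f * c
∑-*ʳ {zero}  f c = refl
∑-*ʳ {suc n} f c = trans (cong (f fzero * c +_) (∑-*ʳ (f ∘ fsuc) c)) (sym (*-distribʳ-+ c (f fzero) _))

∑-pick : ∀ {n} (f : Fin n → ℕ) v → ∑ f ≡ f v + ∑[ i < n ] (if v =ᵇ i then 0 else f i)
∑-pick {suc n} f fzero    = refl
∑-pick {suc n} f (fsuc v) = begin
  f fzero + ∑ (f ∘ fsuc)      ≡⟨ cong (f fzero +_) (∑-pick (f ∘ fsuc) v) ⟩
  f fzero + (f (fsuc v) + R)  ≡⟨ +-assoc (f fzero) _ R ⟨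
  f fzero + f (fsuc v) + R    ≡⟨ cong (_+ R) (+-comm (f fzero) _) ⟩
  f (fsuc v) + f fzero + R    ≡⟨ +-assoc (f (fsuc v)) _ R ⟩
  f (fsuc v) + (f fzero + R)  ∎
  where
  open ≡-Reasoning
  R : ℕ
  R = ∑[ i < n ] (if v =ᵇ i then 0 else f (fsuc i))

sum-map-allFin : ∀ {n} (f : Fin n → ℕ) → sum (map f (allFin n)) ≡ ∑ f
sum-map-allFin f = trans (cong sum (map-tabulate id f)) (sum-tabulate f)
  where
  sum-tabulate : ∀ {n} (g : Fin n → ℕ) → sum (tabulate g) ≡ ∑ g
  sum-tabulate {zero}  g = refl
  sum-tabulate {suc n} g = cong (g fzero +_) (sum-tabulate (g ∘ fsuc))

count : ∀ {n} → (Vec Bool n → Bool) → ℕ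
count {zero}  p = [ p [] ]
count {suc n} p = count (p ∘ (true ∷_)) + count (p ∘ (false ∷_))

sum-map-allSubsets : ∀ {n} (p : Vec Bool n → Bool) → sum (map (λ S → [ p S ]) (allSubsets n)) ≡ count p
sum-map-allSubsets {zero}  p = +-identityʳ [ p [] ]
sum-map-allSubsets {suc n} p = begin
  sum (map f (ts ++ fs))                   ≡⟨ cong sum (map-++ f ts fs) ⟩
  sum (map f ts ++ map f fs)               ≡⟨ sum-++ (map f ts) (map f fs) ⟩
  sum (map f ts) + sum (map f fs)          ≡⟨ cong₂ _+_ (cong sum (map-∘ (allSubsets n))) (cong sum (map-∘ (allSubsets n))) ⟨
  sum (map (f ∘ (true ∷_)) (allSubsets n)) + sum (map (f ∘ (false ∷_)) (allSubsets n))
    ≡⟨ cong₂ _+_ (sum-map-allSubsets (p ∘ (true ∷_))) (sum-map-allSubsets (p ∘ (false ∷_))) ⟩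
  count p                                  ∎
  where
  open ≡-Reasoning
  f : Vec Bool (suc n) → ℕ
  f S = [ p S ]
  ts fs : List (Vec Bool (suc n))
  ts = map (true ∷_) (allSubsets n)
  fs = map (false ∷_) (allSubsets n)

count-mono : ∀ {n} {p q : Vec Bool n → Bool} → (∀ S → p S ≡ true → q S ≡ true) → count p ≤ count q
count-mono {zero}  p⇒q = []-mono (p⇒q [])
count-mono {suc n} p⇒q = +-mono-≤ (count-mono (p⇒q ∘ (true ∷_))) (count-mono (p⇒q ∘ (false ∷_)))

count-cong : ∀ {n} {p q : Vec Bool n → Bool} →
  (∀ S → p S ≡ true → q S ≡ true) → (∀ S → q S ≡ true → p S ≡ true) → count p ≡ count q
count-cong p⇒q q⇒p = ≤-antisym (count-mono p⇒q) (count-mono q⇒p)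

count-≗ : ∀ {n} {p q : Vec Bool n → Bool} → (∀ S → p S ≡ q S) → count p ≡ count q
count-≗ p≗q = count-cong (λ S e → trans (sym (p≗q S)) e) (λ S e → trans (p≗q S) e)

count-none : ∀ {n} (p : Vec Bool n → Bool) → (∀ S → p S ≡ false) → count p ≡ 0
count-none {zero}  p ¬p = cong [_] (¬p [])
count-none {suc n} p ¬p = cong₂ _+_ (count-none _ (¬p ∘ (true ∷_))) (count-none _ (¬p ∘ (false ∷_)))

count-split : ∀ {n} (p q : Vec Bool n → Bool) →
  count p ≡ count (λ S → p S ∧ q S) + count (λ S → p S ∧ not (q S))
count-split {zero} p q with p [] | q []
... | true  | true  = refl
... | true  | false = refl
... | false | _     = refl
count-split {suc n} p q = begin
  count (p ∘ (true ∷_)) + count (p ∘ (false ∷_))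
    ≡⟨ cong₂ _+_ (count-split (p ∘ (true ∷_)) (q ∘ (true ∷_))) (count-split (p ∘ (false ∷_)) (q ∘ (false ∷_))) ⟩
  (count (pq ∘ (true ∷_)) + count (pq̅ ∘ (true ∷_))) + (count (pq ∘ (false ∷_)) + count (pq̅ ∘ (false ∷_)))
    ≡⟨ +-interchange (count (pq ∘ (true ∷_))) _ _ _ ⟩
  count pq + count pq̅ ∎
  where
  open ≡-Reasoning
  pq pq̅ : Vec Bool (suc n) → Bool
  pq  S = p S ∧ q S
  pq̅ S = p S ∧ not (q S)

binom : ℕ → ℕ → ℕ
binom n       zero    = 1
binom zero    (suc k) = 0
binom (suc n) (suc k) = binom n k + binom n (suc k)

binom≡C : ∀ n k → binom n k ≡ n C k
binom≡C n       zero    = refl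
binom≡C zero    (suc k) = refl
binom≡C (suc n) (suc k) = trans (cong₂ _+_ (binom≡C n k) (binom≡C n (suc k))) (nCk+nC[k+1]≡[n+1]C[k+1] n k)

binom-suc-≤ : ∀ n k → binom n k ≤ binom (suc n) k
binom-suc-≤ n       zero    = ≤-refl
binom-suc-≤ zero    (suc k) = z≤n
binom-suc-≤ (suc n) (suc k) = m≤n+m _ (binom (suc n) k)

binom-mono-≤ : ∀ k {n n′} → n ≤ n′ → binom n k ≤ binom n′ k
binom-mono-≤ k {n} n≤n′ with m≤n⇒∃[o]m+o≡n n≤n′
... | d , refl = go d
  where
  go : ∀ d → binom n k ≤ binom (n + d) k
  go zero    = ≤-reflexive (cong (λ x → binom x k) (sym (+-identityʳ n)))
  go (suc d) = ≤-trans (go d) (subst (λ x → binom (n + d) k ≤ binom x k) (sym (+-suc n d)) (binom-suc-≤ (n + d) k))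

-- Convexity of binomial coefficients in the upper index.
binom-exchange : ∀ c k {y y′} → y ≤ y′ → binom (y + c) k + binom y′ k ≤ binom (y′ + c) k + binom y k
binom-exchange zero    k {y} {y′} _ rewrite +-identityʳ y | +-identityʳ y′ = ≤-reflexive (+-comm (binom y k) _)
binom-exchange (suc c) zero    _ = ≤-refl
binom-exchange (suc c) (suc k) {y} {y′} y≤y′ rewrite +-suc y c | +-suc y′ c = begin
  binom (y + c) k + binom (y + c) (suc k) + binom y′ (suc k)
    ≡⟨ +-assoc (binom (y + c) k) _ _ ⟩
  binom (y + c) k + (binom (y + c) (suc k) + binom y′ (suc k))
    ≤⟨ +-mono-≤ (binom-mono-≤ k (+-monoˡ-≤ c y≤y′)) (binom-exchange c (suc k) y≤y′) ⟩
  binom (y′ + c) k + (binom (y′ + c) (suc k) + binom y (suc k))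
    ≡⟨ +-assoc (binom (y′ + c) k) _ _ ⟨
  binom (y′ + c) k + binom (y′ + c) (suc k) + binom y (suc k) ∎
  where open ≤-Reasoning

binom-superadditive : ∀ k x d → binom x (suc k) + binom d (suc k) ≤ binom (x + d) (suc k)
binom-superadditive k x d =
  subst (λ z → binom x (suc k) + binom d (suc k) ≤ z)
    (trans (+-identityʳ _) (cong (λ z → binom z (suc k)) (+-comm d x)))
    (binom-exchange x (suc k) {0} {d} z≤n)

allᶠ : ∀ {n} → (Fin n → Bool) → Bool
allᶠ {zero}  f = true
allᶠ {suc n} f = f fzero ∧ allᶠ (f ∘ fsuc)

allᶠ-elim : ∀ {n} (f : Fin n → Bool) → allᶠ f ≡ true → ∀ i → f i ≡ true
allᶠ-elim f p fzero    = ∧-conicalˡ _ _ p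
allᶠ-elim f p (fsuc i) = allᶠ-elim (f ∘ fsuc) (∧-conicalʳ _ _ p) i

allᶠ-intro : ∀ {n} (f : Fin n → Bool) → (∀ i → f i ≡ true) → allᶠ f ≡ true
allᶠ-intro {zero}  f _ = refl
allᶠ-intro {suc n} f h = ∧-intro (h fzero) (allᶠ-intro (f ∘ fsuc) (h ∘ fsuc))

allᶠ-cong : ∀ {n} {f g : Fin n → Bool} → (∀ i → f i ≡ g i) → allᶠ f ≡ allᶠ g
allᶠ-cong {zero}  _   = refl
allᶠ-cong {suc n} f≗g = cong₂ _∧_ (f≗g fzero) (allᶠ-cong (f≗g ∘ fsuc))

andL-map-allFin : ∀ {n} (f : Fin n → Bool) → andL (map f (allFin n)) ≡ allᶠ f
andL-map-allFin f = trans (cong andL (map-tabulate id f)) (andL-tabulate f)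
  where
  andL-tabulate : ∀ {n} (g : Fin n → Bool) → andL (tabulate g) ≡ allᶠ g
  andL-tabulate {zero}  g = refl
  andL-tabulate {suc n} g = cong (g fzero ∧_) (andL-tabulate (g ∘ fsuc))

data Role : Set where
  member nonmember optional : Role

allows : Role → Bool → Bool
allows member    b = b
allows nonmember b = not b
allows optional  _ = true

isMember : Role → Bool
isMember member = true
isMember _      = false

isOptional : Role → Bool
isOptional optional = true
isOptional _        = false

fits : ∀ {n} → (Fin n → Role) → Vec Bool n → Bool
fits P S = allᶠ (λ i → allows (P i) (lookup S i))

members optionals : ∀ {n} → (Fin n → Role) → ℕ
members   P = ∑ (λ i → [ isMember (P i) ])
optionals P = ∑ (λ i → [ isOptional (P i) ])

-- Number of j-sets containing a fixed a-set and otherwise drawn from f further elements: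
-- C(f, j − a), which is 0 (not C(f, 0)) when j < a.
completions : ℕ → ℕ → ℕ → ℕ
completions f zero    j       = binom f j
completions f (suc a) zero    = 0
completions f (suc a) (suc j) = completions f a j

completions-pascal : ∀ f a j → completions f (suc a) j + completions f a j ≡ completions (suc f) a j
completions-pascal f zero    zero    = refl
completions-pascal f zero    (suc j) = refl
completions-pascal f (suc a) zero    = refl
completions-pascal f (suc a) (suc j) = completions-pascal f a j

completions-empty : ∀ a j → [ (a == j) ∧ true ] ≡ completions 0 a j
completions-empty zero    zero    = refl
completions-empty zero    (suc j) = refl
completions-empty (suc a) zero    = refl
completions-empty (suc a) (suc j) = completions-empty a j

count-fits-offset : ∀ {n} (P : Fin n → Role) c j →
  count (λ S → ((c + size S) == j) ∧ fits P S) ≡ completions (optionals P) (c + members P) j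
count-fits-offset {zero}  P c j rewrite +-identityʳ c = completions-empty c j
count-fits-offset {suc n} P c j with P fzero
... | member = begin
  count {n} (λ S → ((c + suc (size S)) == j) ∧ fits P′ S) + count {n} (λ S → ((c + size S) == j) ∧ false)
    ≡⟨ cong₂ _+_ (count-≗ (λ S → cong (λ x → (x == j) ∧ fits P′ S) (+-suc c (size S))))
                 (count-none {n} _ (λ S → ∧-zeroʳ ((c + size S) == j))) ⟩
  count {n} (λ S → ((suc c + size S) == j) ∧ fits P′ S) + 0
    ≡⟨ +-identityʳ _ ⟩
  count {n} (λ S → ((suc c + size S) == j) ∧ fits P′ S)
    ≡⟨ count-fits-offset P′ (suc c) j ⟩
  completions (optionals P′) (suc c + members P′) j
    ≡⟨ cong (λ a → completions (optionals P′) a j) (+-suc c (members P′)) ⟨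
  completions (optionals P′) (c + suc (members P′)) j ∎
  where
  open ≡-Reasoning
  P′ : Fin n → Role
  P′ = P ∘ fsuc
... | nonmember = begin
  count {n} (λ S → ((c + suc (size S)) == j) ∧ false) + count {n} (λ S → ((c + size S) == j) ∧ fits P′ S)
    ≡⟨ cong (_+ count {n} (λ S → ((c + size S) == j) ∧ fits P′ S))
            (count-none {n} _ (λ S → ∧-zeroʳ ((c + suc (size S)) == j))) ⟩
  count {n} (λ S → ((c + size S) == j) ∧ fits P′ S)
    ≡⟨ count-fits-offset P′ c j ⟩
  completions (optionals P′) (c + members P′) j ∎
  where
  open ≡-Reasoning
  P′ : Fin n → Role
  P′ = P ∘ fsuc
... | optional = begin
  count {n} (λ S → ((c + suc (size S)) == j) ∧ fits P′ S) + count {n} (λ S → ((c + size S) == j) ∧ fits P′ S)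
    ≡⟨ cong (_+ count {n} (λ S → ((c + size S) == j) ∧ fits P′ S)) (count-≗ (λ S → cong (λ x → (x == j) ∧ fits P′ S) (+-suc c (size S)))) ⟩
  count {n} (λ S → ((suc c + size S) == j) ∧ fits P′ S) + count {n} (λ S → ((c + size S) == j) ∧ fits P′ S)
    ≡⟨ cong₂ _+_ (count-fits-offset P′ (suc c) j) (count-fits-offset P′ c j) ⟩
  completions (optionals P′) (suc (c + members P′)) j + completions (optionals P′) (c + members P′) j
    ≡⟨ completions-pascal (optionals P′) (c + members P′) j ⟩
  completions (suc (optionals P′)) (c + members P′) j ∎
  where
  open ≡-Reasoning
  P′ : Fin n → Role
  P′ = P ∘ fsuc

count-fits : ∀ {n} (P : Fin n → Role) j →
  count (λ S → (size S == j) ∧ fits P S) ≡ completions (optionals P) (members P) j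
count-fits P = count-fits-offset P 0

tri : ℕ → ℕ
tri zero    = 0
tri (suc s) = tri s + s

tri-mono-≤ : ∀ {s s′} → s ≤ s′ → tri s ≤ tri s′
tri-mono-≤ {s} s≤s′ with m≤n⇒∃[o]m+o≡n s≤s′
... | d , refl = go d
  where
  go : ∀ d → tri s ≤ tri (s + d)
  go zero    = ≤-reflexive (cong tri (sym (+-identityʳ s)))
  go (suc d) = subst (λ z → tri s ≤ tri z) (sym (+-suc s d)) (≤-trans (go d) (m≤m+n _ (s + d)))

2*tri-suc : ∀ s → 2 * tri (suc s) ≡ suc s * s
2*tri-suc zero    = refl
2*tri-suc (suc s) = begin
  2 * (tri (suc s) + suc s)     ≡⟨ *-distribˡ-+ 2 (tri (suc s)) (suc s) ⟩
  2 * tri (suc s) + 2 * suc s   ≡⟨ cong (_+ 2 * suc s) (2*tri-suc s) ⟩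
  suc s * s + 2 * suc s         ≡⟨ expand s ⟩
  suc (suc s) * suc s           ∎
  where
  open ≡-Reasoning
  expand : ∀ s → suc s * s + 2 * suc s ≡ suc (suc s) * suc s
  expand = solve-∀

2*tri : ∀ s → 2 * tri s ≡ s * (s ∸ 1)
2*tri zero    = refl
2*tri (suc s) = 2*tri-suc s

-- For N = C(s,2) + q with q < s, the Kruskal–Katona bound C(q, j+1) + C(s, j+2) on the number
-- of (j+2)-cliques in a graph with N edges.
cascadeBound : ℕ → ℕ → ℕ → ℕ
cascadeBound j s q = binom q (suc j) + binom s (suc (suc j))

CascadeStep : ℕ → ℕ → ℕ → ℕ → Set
CascadeStep j x s q = ∃₂ λ s′ q′ → tri s′ + q′ + x ≡ tri s + q × q′ < s′ ×
  binom x (suc j) + cascadeBound j s′ q′ ≤ cascadeBound j s q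

cascade-step-within : ∀ j x d s → x + d < s → CascadeStep j x s (x + d)
cascade-step-within j x d s x+d<s = s , d , reassoc (tri s) x d , ≤-<-trans (m≤n+m d x) x+d<s , (begin
  binom x (suc j) + (binom d (suc j) + binom s (suc (suc j)))
    ≡⟨ +-assoc (binom x (suc j)) _ _ ⟨
  binom x (suc j) + binom d (suc j) + binom s (suc (suc j))
    ≤⟨ +-monoˡ-≤ _ (binom-superadditive j x d) ⟩
  binom (x + d) (suc j) + binom s (suc (suc j)) ∎)
  where
  open ≤-Reasoning
  reassoc : ∀ t x d → t + d + x ≡ t + (x + d)
  reassoc = solve-∀

cascade-step-across : ∀ j x g q → q < x → CascadeStep j x (suc (x + g)) q
cascade-step-across j x g q q<x = x + g , q + g , regroup (tri (x + g)) x g q , +-monoˡ-< g q<x , (begin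
  binom x (suc j) + (binom (q + g) (suc j) + B)
    ≡⟨ +-assoc (binom x (suc j)) _ B ⟨
  binom x (suc j) + binom (q + g) (suc j) + B
    ≡⟨ cong (_+ B) (+-comm (binom x (suc j)) _) ⟩
  binom (q + g) (suc j) + binom x (suc j) + B
    ≤⟨ +-monoˡ-≤ B (binom-exchange g (suc j) (<⇒≤ q<x)) ⟩
  binom (x + g) (suc j) + binom q (suc j) + B
    ≡⟨ cong (_+ B) (+-comm (binom (x + g) (suc j)) _) ⟩
  binom q (suc j) + binom (x + g) (suc j) + B
    ≡⟨ +-assoc (binom q (suc j)) _ B ⟩
  binom q (suc j) + (binom (x + g) (suc j) + B) ∎)
  where
  open ≤-Reasoning
  B : ℕ
  B = binom (x + g) (suc (suc j))
  regroup : ∀ t x g q → t + (q + g) + x ≡ t + (x + g) + q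
  regroup = solve-∀

cascade-step : ∀ j x s q → q < s → tri (suc x) ≤ tri s + q → CascadeStep j x s q
cascade-step j x s q q<s tx≤N with x ≤? q | x <? s
... | yes x≤q | _ with m≤n⇒∃[o]m+o≡n x≤q
...   | d , refl = cascade-step-within j x d s q<s
cascade-step j x s q q<s tx≤N | no x≰q | yes x<s with m≤n⇒∃[o]m+o≡n x<s
...   | g , refl = cascade-step-across j x g q (≰⇒> x≰q)
cascade-step j x s q q<s tx≤N | no _ | no x≮s = ⊥-elim (<-irrefl refl (begin-strict
  tri (suc s)   ≤⟨ tri-mono-≤ (s≤s (≮⇒≥ x≮s)) ⟩
  tri (suc x)   ≤⟨ tx≤N ⟩
  tri s + q     <⟨ +-monoʳ-< (tri s) q<s ⟩
  tri (suc s)   ∎))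
  where open ≤-Reasoning

card : ∀ {n} → (Fin n → Bool) → ℕ
card U = ∑ (λ i → [ U i ])

_∖_ : ∀ {n} → (Fin n → Bool) → Fin n → Fin n → Bool
(U ∖ v) i = U i ∧ not (v =ᵇ i)

card-∖ : ∀ {n} (U : Fin n → Bool) v → U v ≡ true → card U ≡ suc (card (U ∖ v))
card-∖ U v Uv = trans (∑-pick (λ i → [ U i ]) v) (cong₂ _+_ (cong [_] Uv) (sum-cong-≗ (λ i → drop (v =ᵇ i) (U i))))
  where
  drop : ∀ e u → (if e then 0 else [ u ]) ≡ [ u ∧ not e ]
  drop true  true  = refl
  drop true  false = refl
  drop false true  = refl
  drop false false = refl

card-full : ∀ n → card {n} (λ _ → true) ≡ n
card-full n = trans (∑-const n 1) (*-identityʳ n)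

card-≡0 : ∀ {n} (U : Fin n → Bool) → card U ≡ 0 → ∀ i → U i ≡ false
card-≡0 U card≡0 i with U i in Ui
... | false = refl
... | true  = ⊥-elim (0≢1+n (trans (sym card≡0) (card-∖ U i Ui)))

argmin : ∀ {n} (U : Fin n → Bool) (f : Fin n → ℕ) →
  (Σ (Fin n) λ v → U v ≡ true × (∀ i → U i ≡ true → f v ≤ f i)) ⊎ (∀ i → U i ≡ false)
argmin {zero} U f = inj₂ (λ ())
argmin {suc n} U f with U fzero in U0 | argmin (U ∘ fsuc) (f ∘ fsuc)
... | false | inj₂ none = inj₂ λ { fzero → U0 ; (fsuc i) → none i }
... | false | inj₁ (v , Uv , min) = inj₁ (fsuc v , Uv , λ
  { fzero Ui → ⊥-elim (true≢false (trans (sym Ui) U0)) ; (fsuc i) Ui → min i Ui })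
... | true  | inj₂ none = inj₁ (fzero , U0 , λ
  { fzero _ → ≤-refl ; (fsuc i) Ui → ⊥-elim (true≢false (trans (sym Ui) (none i))) })
... | true  | inj₁ (v , Uv , min) with f fzero ≤? f (fsuc v)
...   | yes f0≤ = inj₁ (fzero , U0 , λ { fzero _ → ≤-refl ; (fsuc i) Ui → ≤-trans f0≤ (min i Ui) })
...   | no  f0≰ = inj₁ (fsuc v , Uv , λ { fzero _ → <⇒≤ (≰⇒> f0≰) ; (fsuc i) Ui → min i Ui })

within : ∀ {n} → (Fin n → Bool) → Fin n → Role
within U i = if U i then optional else nonmember

_⊆ᵇ_ : ∀ {n} → Vec Bool n → (Fin n → Bool) → Bool
S ⊆ᵇ U = fits (within U) S

_∈ᵛ_ : ∀ {n} → Fin n → Vec Bool n → Set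
i ∈ᵛ S = lookup S i ≡ true

allows-within : ∀ u s → (s ≡ true → u ≡ true) → allows (if u then optional else nonmember) s ≡ true
allows-within true  _     _ = refl
allows-within false false _ = refl
allows-within false true  h = h refl

allows-within⁻¹ : ∀ u s → allows (if u then optional else nonmember) s ≡ true → s ≡ true → u ≡ true
allows-within⁻¹ true  _    _ _ = refl
allows-within⁻¹ false true () _

⊆ᵇ-elim : ∀ {n} (S : Vec Bool n) U → S ⊆ᵇ U ≡ true → ∀ {i} → i ∈ᵛ S → U i ≡ true
⊆ᵇ-elim S U S⊆U {i} = allows-within⁻¹ (U i) (lookup S i) (allᶠ-elim _ S⊆U i)

⊆ᵇ-intro : ∀ {n} (S : Vec Bool n) U → (∀ {i} → i ∈ᵛ S → U i ≡ true) → S ⊆ᵇ U ≡ true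
⊆ᵇ-intro S U S⊆U = allᶠ-intro _ (λ i → allows-within (U i) (lookup S i) S⊆U)

optionals-within : ∀ {n} (U : Fin n → Bool) → optionals (within U) ≡ card U
optionals-within U = sum-cong-≗ (λ i → go (U i))
  where
  go : ∀ u → [ isOptional (if u then optional else nonmember) ] ≡ [ u ]
  go true  = refl
  go false = refl

members-within : ∀ {n} (U : Fin n → Bool) → members (within U) ≡ 0
members-within {n} U = trans (sum-cong-≗ (λ i → go (U i))) (sum-replicate-zero n)
  where
  go : ∀ u → [ isMember (if u then optional else nonmember) ] ≡ 0
  go true  = refl
  go false = refl

module GraphCounting {n : ℕ} (G : Graph n) where

  Independent : Vec Bool n → Set
  Independent S = ∀ {i j} → i ∈ᵛ S → j ∈ᵛ S → adj G i j ≡ false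

  IndependentSet : (Fin n → Bool) → Set
  IndependentSet U = ∀ {i j} → U i ≡ true → U j ≡ true → adj G i j ≡ false

  private
    allPairs : ∀ S → isIndependent G S ≡ allᶠ (λ i → allᶠ (λ j → not (lookup S i ∧ lookup S j ∧ adj G i j)))
    allPairs S = trans (andL-map-allFin {n} _) (allᶠ-cong {n} (λ i → andL-map-allFin {n} _))

  isIndependent-sound : ∀ S → isIndependent G S ≡ true → Independent S
  isIndependent-sound S indep {i} {j} i∈S j∈S =
    go i∈S j∈S (allᶠ-elim _ (allᶠ-elim _ (trans (sym (allPairs S)) indep) i) j)
    where
    go : ∀ {a b c} → a ≡ true → b ≡ true → not (a ∧ b ∧ c) ≡ true → c ≡ false
    go {c = false} refl refl _ = refl

  isIndependent-complete : ∀ S → Independent S → isIndependent G S ≡ true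
  isIndependent-complete S indep =
    trans (allPairs S) (allᶠ-intro _ λ i → allᶠ-intro _ λ j → go (lookup S i) (lookup S j) indep)
    where
    go : ∀ a b {c} → (a ≡ true → b ≡ true → c ≡ false) → not (a ∧ b ∧ c) ≡ true
    go false _     _ = refl
    go true  false _ = refl
    go true  true  h rewrite h refl refl = refl

  coAdj : Fin n → Fin n → Bool
  coAdj i j = not (i =ᵇ j) ∧ not (adj G i j)

  coAdj-sym : ∀ i j → coAdj i j ≡ coAdj j i
  coAdj-sym i j = cong₂ (λ a b → not a ∧ not b) (=ᵇ-sym i j) (Graph.sym G i j)

  coAdj⇒¬adj : ∀ i j → coAdj i j ≡ true → adj G i j ≡ false
  coAdj⇒¬adj i j = go (i =ᵇ j) (adj G i j)
    where
    go : ∀ e a → not e ∧ not a ≡ true → a ≡ false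
    go false false _ = refl

  coDeg : (Fin n → Bool) → Fin n → ℕ
  coDeg U i = ∑[ j < n ] [ U j ∧ coAdj i j ]

  coDegSum : (Fin n → Bool) → ℕ
  coDegSum U = ∑[ i < n ] ([ U i ] * coDeg U i)

  indepIn : ℕ → (Fin n → Bool) → ℕ
  indepIn r U = count (λ S → (size S == r) ∧ (S ⊆ᵇ U ∧ isIndependent G S))

  star : (Fin n → Bool) → Fin n → Fin n → Role
  star U v i = if v =ᵇ i then member else within (λ j → U j ∧ coAdj v j) i

  private
    allows-star : ∀ e w s → (e ≡ true → s ≡ true) → (s ≡ true → e ≡ false → w ≡ true) →
      allows (if e then member else (if w then optional else nonmember)) s ≡ true
    allows-star true  _ _ e⇒s _   = e⇒s refl
    allows-star false w s _   s⇒w = allows-within w s (λ s≡true → s⇒w s≡true refl)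

    allows-star⁻¹ : ∀ e w s → allows (if e then member else (if w then optional else nonmember)) s ≡ true →
      s ≡ true → e ≡ true ⊎ w ≡ true
    allows-star⁻¹ true  _     _    _  _ = inj₁ refl
    allows-star⁻¹ false true  _    _  _ = inj₂ refl
    allows-star⁻¹ false false true () _

    ∉⇒≠ : ∀ (S : Vec Bool n) v i → not (lookup S v) ≡ true → i ∈ᵛ S → not (v =ᵇ i) ≡ true
    ∉⇒≠ S v i v∉S i∈S with v =ᵇ i in v=i
    ... | false = refl
    ... | true  = ⊥-elim (true≢false (sym (trans (sym (cong not v∈S)) v∉S)))
      where
      v∈S : v ∈ᵛ S
      v∈S = subst (_∈ᵛ S) (sym (=ᵇ⇒≡ v i v=i)) i∈S

  star-elim : ∀ U v S → fits (star U v) S ≡ true →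
    v ∈ᵛ S × (∀ {i} → i ∈ᵛ S → v ≡ i ⊎ (U i ∧ coAdj v i) ≡ true)
  star-elim U v S fit = v∈S , others
    where
    v∈S : v ∈ᵛ S
    v∈S = subst (λ e → allows (if e then member else within (λ j → U j ∧ coAdj v j) v) (lookup S v) ≡ true)
                (=ᵇ-refl v) (allᶠ-elim _ fit v)
    others : ∀ {i} → i ∈ᵛ S → v ≡ i ⊎ (U i ∧ coAdj v i) ≡ true
    others {i} i∈S with allows-star⁻¹ (v =ᵇ i) (U i ∧ coAdj v i) (lookup S i) (allᶠ-elim _ fit i) i∈S
    ... | inj₁ v=i = inj₁ (=ᵇ⇒≡ v i v=i)
    ... | inj₂ coNbr = inj₂ coNbr

  isIndepIn : ℕ → (Fin n → Bool) → Vec Bool n → Bool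
  isIndepIn r U S = (size S == r) ∧ (S ⊆ᵇ U ∧ isIndependent G S)

  record IndepIn (r : ℕ) (U : Fin n → Bool) (S : Vec Bool n) : Set where
    field
      hasSize  : (size S == r) ≡ true
      ⊆U       : ∀ {i} → i ∈ᵛ S → U i ≡ true
      isIndep  : Independent S

  isIndepIn-sound : ∀ r U S → isIndepIn r U S ≡ true → IndepIn r U S
  isIndepIn-sound r U S h with ∧-elim (size S == r) h
  ... | sz , h′ with ∧-elim (S ⊆ᵇ U) h′
  ...   | S⊆U , ind = record { hasSize = sz ; ⊆U = ⊆ᵇ-elim S U S⊆U ; isIndep = isIndependent-sound S ind }

  isIndepIn-complete : ∀ r U S → IndepIn r U S → isIndepIn r U S ≡ true
  isIndepIn-complete r U S I =
    ∧-intro (IndepIn.hasSize I) (∧-intro (⊆ᵇ-intro S U (IndepIn.⊆U I)) (isIndependent-complete S (IndepIn.isIndep I)))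

  indepThrough : ℕ → (Fin n → Bool) → Fin n → ℕ
  indepThrough r U v = count (λ S → isIndepIn r U S ∧ lookup S v)

  indepIn-split : ∀ r U v → indepIn r U ≡ indepThrough r U v + indepIn r (U ∖ v)
  indepIn-split r U v =
    trans (count-split (isIndepIn r U) (λ S → lookup S v)) (cong (indepThrough r U v +_) (count-cong avoid⇒ ⇒avoid))
    where
    avoid⇒ : ∀ S → isIndepIn r U S ∧ not (lookup S v) ≡ true → isIndepIn r (U ∖ v) S ≡ true
    avoid⇒ S h with ∧-elim (isIndepIn r U S) h
    ... | h′ , v∉S = isIndepIn-complete r (U ∖ v) S (record
      { hasSize = IndepIn.hasSize I ; ⊆U = λ i∈S → ∧-intro (IndepIn.⊆U I i∈S) (∉⇒≠ S v _ v∉S i∈S) ; isIndep = IndepIn.isIndep I })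
      where
      I : IndepIn r U S
      I = isIndepIn-sound r U S h′
    ⇒avoid : ∀ S → isIndepIn r (U ∖ v) S ≡ true → isIndepIn r U S ∧ not (lookup S v) ≡ true
    ⇒avoid S h = ∧-intro (isIndepIn-complete r U S (record
      { hasSize = IndepIn.hasSize I ; ⊆U = λ i∈S → proj₁ (∧-elim (U _) (IndepIn.⊆U I i∈S)) ; isIndep = IndepIn.isIndep I }))
      v∉S
      where
      I : IndepIn r (U ∖ v) S
      I = isIndepIn-sound r (U ∖ v) S h
      v∉S : not (lookup S v) ≡ true
      v∉S with lookup S v in v∈S
      ... | false = refl
      ... | true  = ⊥-elim (true≢false (trans (sym (proj₂ (∧-elim (U v) (IndepIn.⊆U I v∈S)))) (cong not (=ᵇ-refl v))))

  through⇒star : ∀ r U v S → isIndepIn r U S ∧ lookup S v ≡ true → (size S == r) ∧ fits (star U v) S ≡ true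
  through⇒star r U v S h with ∧-elim (isIndepIn r U S) h
  ... | h′ , v∈S = ∧-intro (IndepIn.hasSize I) (allᶠ-intro _ (λ i →
    allows-star (v =ᵇ i) (U i ∧ coAdj v i) (lookup S i)
      (λ v=i → subst (_∈ᵛ S) (=ᵇ⇒≡ v i v=i) v∈S)
      (λ i∈S v≠i → ∧-intro (IndepIn.⊆U I i∈S)
        (∧-intro (cong not v≠i) (cong not (IndepIn.isIndep I v∈S i∈S))))))
    where
    I : IndepIn r U S
    I = isIndepIn-sound r U S h′

  star⇒through : ∀ r U v → U v ≡ true → IndependentSet (λ i → U i ∧ coAdj v i) →
    ∀ S → (size S == r) ∧ fits (star U v) S ≡ true → isIndepIn r U S ∧ lookup S v ≡ true
  star⇒through r U v Uv coNbrs-indep S h with ∧-elim (size S == r) h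
  ... | sz , fit with star-elim U v S fit
  ...   | v∈S , members-of-S =
    ∧-intro (isIndepIn-complete r U S (record { hasSize = sz ; ⊆U = S⊆U ; isIndep = ind })) v∈S
    where
    S⊆U : ∀ {i} → i ∈ᵛ S → U i ≡ true
    S⊆U i∈S with members-of-S i∈S
    ... | inj₁ refl  = Uv
    ... | inj₂ coNbr = proj₁ (∧-elim (U _) coNbr)
    ind : Independent S
    ind i∈S j∈S with members-of-S i∈S | members-of-S j∈S
    ... | inj₁ refl | inj₁ refl = Graph.irrefl G v
    ... | inj₁ refl | inj₂ cj   = coAdj⇒¬adj v _ (proj₂ (∧-elim (U _) cj))
    ... | inj₂ ci   | inj₁ refl = trans (Graph.sym G _ v) (coAdj⇒¬adj v _ (proj₂ (∧-elim (U _) ci)))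
    ... | inj₂ ci   | inj₂ cj   = coNbrs-indep ci cj

  count-star : ∀ U v j → count (λ S → (size S == suc j) ∧ fits (star U v) S) ≡ binom (coDeg U v) j
  count-star U v j = trans (count-fits (star U v) (suc j))
    (cong₂ (λ f a → completions f a (suc j)) (sum-cong-≗ (λ i → optional-star (v =ᵇ i) (U i) _)) members-star)
    where
    optional-star : ∀ e u c →
      [ isOptional (if e then member else (if u ∧ (not e ∧ c) then optional else nonmember)) ] ≡ [ u ∧ (not e ∧ c) ]
    optional-star true  true  _     = refl
    optional-star true  false _     = refl
    optional-star false true  true  = refl
    optional-star false true  false = refl
    optional-star false false _     = refl
    other-member : ∀ e w → (if e then 0 else [ isMember (if e then member else (if w then optional else nonmember)) ]) ≡ 0
    other-member true  _     = refl
    other-member false true  = refl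
    other-member false false = refl
    members-star : members (star U v) ≡ 1
    members-star = trans (∑-pick _ v) (cong₂ _+_
      (cong (λ e → [ isMember (if e then member else within (λ j → U j ∧ coAdj v j) v) ]) (=ᵇ-refl v))
      (trans (sum-cong-≗ (λ i → other-member (v =ᵇ i) (U i ∧ coAdj v i))) (sum-replicate-zero n)))

  indepIn-remove-≤ : ∀ j U v → indepIn (suc j) U ≤ binom (coDeg U v) j + indepIn (suc j) (U ∖ v)
  indepIn-remove-≤ j U v = begin
    indepIn (suc j) U                                   ≡⟨ indepIn-split (suc j) U v ⟩
    indepThrough (suc j) U v + indepIn (suc j) (U ∖ v)  ≤⟨ +-monoˡ-≤ _ (count-mono (through⇒star (suc j) U v)) ⟩
    count (λ S → (size S == suc j) ∧ fits (star U v) S) + indepIn (suc j) (U ∖ v)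
                                                        ≡⟨ cong (_+ indepIn (suc j) (U ∖ v)) (count-star U v j) ⟩
    binom (coDeg U v) j + indepIn (suc j) (U ∖ v)       ∎
    where open ≤-Reasoning

  indepIn-remove : ∀ j U v → U v ≡ true → IndependentSet (λ i → U i ∧ coAdj v i) →
    indepIn (suc j) U ≡ binom (coDeg U v) j + indepIn (suc j) (U ∖ v)
  indepIn-remove j U v Uv coNbrs-indep = begin
    indepIn (suc j) U                                   ≡⟨ indepIn-split (suc j) U v ⟩
    indepThrough (suc j) U v + indepIn (suc j) (U ∖ v)
      ≡⟨ cong (_+ indepIn (suc j) (U ∖ v))
              (trans (count-cong (through⇒star (suc j) U v) (star⇒through (suc j) U v Uv coNbrs-indep)) (count-star U v j)) ⟩
    binom (coDeg U v) j + indepIn (suc j) (U ∖ v)       ∎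
    where open ≡-Reasoning

  coDeg-remove : ∀ U v → U v ≡ true → ∀ i → coDeg U i ≡ [ coAdj i v ] + coDeg (U ∖ v) i
  coDeg-remove U v Uv i = trans (∑-pick _ v) (cong₂ _+_ (cong (λ u → [ u ∧ coAdj i v ]) Uv)
    (sum-cong-≗ (λ k → drop (v =ᵇ k) (U k) (coAdj i k))))
    where
    drop : ∀ e u c → (if e then 0 else [ u ∧ c ]) ≡ [ (u ∧ not e) ∧ c ]
    drop true  true  _ = refl
    drop true  false _ = refl
    drop false true  _ = refl
    drop false false _ = refl

  coDegSum-remove : ∀ U v → U v ≡ true → coDegSum U ≡ coDegSum (U ∖ v) + 2 * coDeg U v
  coDegSum-remove U v Uv = begin
    coDegSum U
      ≡⟨ ∑-pick _ v ⟩
    [ U v ] * coDeg U v + ∑[ i < n ] (if v =ᵇ i then 0 else [ U i ] * coDeg U i)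
      ≡⟨ cong₂ _+_ (cong (λ u → [ u ] * coDeg U v) Uv)
                   (sum-cong-≗ (λ i → trans (cong (λ d → if v =ᵇ i then 0 else [ U i ] * d) (coDeg-remove U v Uv i))
                                            (split (v =ᵇ i) (U i) [ coAdj i v ] (coDeg (U ∖ v) i)))) ⟩
    coDeg U v + 0 + ∑[ i < n ] ([ (U ∖ v) i ] * coDeg (U ∖ v) i + [ (U ∖ v) i ] * [ coAdj i v ])
      ≡⟨ cong (coDeg U v + 0 +_) (∑-distrib-+ {n} _ _) ⟩
    coDeg U v + 0 + (coDegSum (U ∖ v) + ∑[ i < n ] ([ (U ∖ v) i ] * [ coAdj i v ]))
      ≡⟨ cong (λ z → coDeg U v + 0 + (coDegSum (U ∖ v) + z))
              (sum-cong-≗ (λ i → trans (cong (λ c → [ (U ∖ v) i ] * [ c ]) (coAdj-sym i v))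
                                       (merge (U i) (v =ᵇ i) (not (adj G v i))))) ⟩
    coDeg U v + 0 + (coDegSum (U ∖ v) + coDeg U v)
      ≡⟨ rearrange (coDeg U v) (coDegSum (U ∖ v)) ⟩
    coDegSum (U ∖ v) + 2 * coDeg U v ∎
    where
    open ≡-Reasoning
    split : ∀ e u a b → (if e then 0 else [ u ] * (a + b)) ≡ [ u ∧ not e ] * b + [ u ∧ not e ] * a
    split true  true  a b = refl
    split true  false a b = refl
    split false true  a b = trans (+-identityʳ (a + b)) (trans (+-comm a b) (cong₂ _+_ (sym (+-identityʳ b)) (sym (+-identityʳ a))))
    split false false a b = refl
    merge : ∀ u e c → [ u ∧ not e ] * [ not e ∧ c ] ≡ [ u ∧ (not e ∧ c) ]
    merge true  true  _     = refl
    merge true  false true  = refl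
    merge true  false false = refl
    merge false _     _     = refl
    rearrange : ∀ x z → x + 0 + (z + x) ≡ z + 2 * x
    rearrange = solve-∀

  coDeg-≤-card : ∀ U v → coDeg U v ≤ card (U ∖ v)
  coDeg-≤-card U v = ∑-mono-≤ (λ k → []-mono (go (U k) (v =ᵇ k) (not (adj G v k))))
    where
    go : ∀ u e c → u ∧ (not e ∧ c) ≡ true → u ∧ not e ≡ true
    go true false true _ = refl

  card*≤coDegSum : ∀ U x → (∀ i → U i ≡ true → x ≤ coDeg U i) → card U * x ≤ coDegSum U
  card*≤coDegSum U x x≤coDeg = begin
    card U * x                    ≡⟨ ∑-*ʳ (λ i → [ U i ]) x ⟨
    ∑[ i < n ] ([ U i ] * x)      ≤⟨ ∑-mono-≤ termwise ⟩
    coDegSum U                    ∎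
    where
    open ≤-Reasoning
    termwise : ∀ i → [ U i ] * x ≤ [ U i ] * coDeg U i
    termwise i with U i in Ui
    ... | true  = +-monoˡ-≤ 0 (x≤coDeg i Ui)
    ... | false = z≤n

  indepIn-independent : ∀ r U → IndependentSet U → indepIn r U ≡ binom (card U) r
  indepIn-independent r U U-indep = begin
    indepIn r U                                        ≡⟨ count-cong (λ S → drop-indep S) (λ S → add-indep S) ⟩
    count (λ S → (size S == r) ∧ fits (within U) S)   ≡⟨ count-fits (within U) r ⟩
    completions (optionals (within U)) (members (within U)) r
                                                       ≡⟨ cong₂ (λ f a → completions f a r) (optionals-within U) (members-within U) ⟩
    binom (card U) r                                   ∎
    where
    open ≡-Reasoning
    drop-indep : ∀ S → isIndepIn r U S ≡ true → (size S == r) ∧ fits (within U) S ≡ true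
    drop-indep S h = ∧-intro (IndepIn.hasSize I) (⊆ᵇ-intro S U (IndepIn.⊆U I))
      where
      I : IndepIn r U S
      I = isIndepIn-sound r U S h
    add-indep : ∀ S → (size S == r) ∧ fits (within U) S ≡ true → isIndepIn r U S ≡ true
    add-indep S h with ∧-elim (size S == r) h
    ... | sz , S⊆U = isIndepIn-complete r U S (record
      { hasSize = sz ; ⊆U = ⊆ᵇ-elim S U S⊆U ; isIndep = λ i∈S j∈S → U-indep (⊆ᵇ-elim S U S⊆U i∈S) (⊆ᵇ-elim S U S⊆U j∈S) })

  coDegSum-independent : ∀ U → IndependentSet U → coDegSum U ≡ card U * (card U ∸ 1)
  coDegSum-independent U U-indep = trans (sum-cong-≗ termwise) (∑-*ʳ (λ i → [ U i ]) (card U ∸ 1))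
    where
    coAdj-within : ∀ u e a → (u ≡ true → a ≡ false) → [ u ∧ (not e ∧ not a) ] ≡ [ u ∧ not e ]
    coAdj-within true  e     false _ = cong [_] (∧-identityʳ (not e))
    coAdj-within true  _     true  h = ⊥-elim (true≢false (h refl))
    coAdj-within false _     _     _ = refl
    termwise : ∀ i → [ U i ] * coDeg U i ≡ [ U i ] * (card U ∸ 1)
    termwise i with U i in Ui
    ... | false = refl
    ... | true  = cong (_+ 0) (trans (sum-cong-≗ (λ k → coAdj-within (U k) (i =ᵇ k) (adj G i k) (U-indep Ui)))
                                     (cong (_∸ 1) (sym (card-∖ U i Ui))))

  indepIn-≗ : ∀ r {U V} → (∀ i → U i ≡ V i) → indepIn r U ≡ indepIn r V
  indepIn-≗ r U≗V = count-≗ (λ S → cong (λ b → (size S == r) ∧ (b ∧ isIndependent G S))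
    (allᶠ-cong (λ i → cong (λ u → allows (if u then optional else nonmember) (lookup S i)) (U≗V i))))

  coDegSum-≗ : ∀ {U V} → (∀ i → U i ≡ V i) → coDegSum U ≡ coDegSum V
  coDegSum-≗ U≗V = sum-cong-≗ (λ i → cong₂ (λ u d → [ u ] * d) (U≗V i)
    (sum-cong-≗ (λ k → cong (λ u → [ u ∧ coAdj i k ]) (U≗V k))))

  full : Fin n → Bool
  full _ = true

  indepCount≡indepIn : ∀ r → indepCount G r ≡ indepIn r full
  indepCount≡indepIn r = trans (sum-map-allSubsets {n} _) (count-≗ (λ S →
    cong (λ b → (size S == r) ∧ (b ∧ isIndependent G S)) (sym (allᶠ-intro _ (λ i → allows-within true (lookup S i) (λ _ → refl))))))

  private
    edge : Fin n → Fin n → ℕ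
    edge i j = [ (toℕ i <ᵇ toℕ j) ∧ adj G i j ]

    pair-classified : ∀ i j → edge i j + edge j i + [ coAdj i j ] ≡ [ not (i =ᵇ j) ]
    pair-classified i j with <-cmp (toℕ i) (toℕ j)
    ... | tri< i<j _ _ rewrite <⇒<ᵇ≡true i<j | ≥⇒<ᵇ≡false (<⇒≤ i<j) | ≢⇒==-false (<⇒≢ i<j) = go (adj G i j)
      where
      go : ∀ b → [ b ] + 0 + [ true ∧ not b ] ≡ 1
      go true  = refl
      go false = refl
    ... | tri> _ _ j<i rewrite <⇒<ᵇ≡true j<i | ≥⇒<ᵇ≡false (<⇒≤ j<i) | ≢⇒==-false (≢-sym (<⇒≢ j<i)) | Graph.sym G j i =
      go (adj G i j)
      where
      go : ∀ b → 0 + [ b ] + [ true ∧ not b ] ≡ 1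
      go true  = refl
      go false = refl
    ... | tri≈ _ i≡j _ rewrite toℕ-injective i≡j | Graph.irrefl G j | ≥⇒<ᵇ≡false (≤-refl {toℕ j}) | ==-refl (toℕ j) = refl

  edges-coDegSum : 2 * edges G + coDegSum full ≡ n * (n ∸ 1)
  edges-coDegSum = begin
    2 * edges G + coDegSum full
      ≡⟨ cong₂ (λ e d → 2 * e + d) (trans (sum-map-allFin {n} _) (sum-cong-≗ {n} (λ i → sum-map-allFin {n} _)))
                                   (sum-cong-≗ {n} (λ i → +-identityʳ (coDeg full i))) ⟩
    2 * E + ∑[ i < n ] ∑[ j < n ] [ coAdj i j ]
      ≡⟨ cong (_+ ∑[ i < n ] ∑[ j < n ] [ coAdj i j ])
              (trans (cong (E +_) (trans (+-identityʳ E) (∑-comm {n} {n} (λ j i → edge j i)))) (sym (∑-distrib-+ {n} _ _))) ⟩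
    ∑[ i < n ] (∑[ j < n ] edge i j + ∑[ j < n ] edge j i) + ∑[ i < n ] ∑[ j < n ] [ coAdj i j ]
      ≡⟨ sym (∑-distrib-+ {n} _ _) ⟩
    ∑[ i < n ] (∑[ j < n ] edge i j + ∑[ j < n ] edge j i + ∑[ j < n ] [ coAdj i j ])
      ≡⟨ sum-cong-≗ {n} (λ i → trans (cong (_+ ∑[ j < n ] [ coAdj i j ]) (sym (∑-distrib-+ {n} _ _)))
                                  (trans (sym (∑-distrib-+ {n} _ _)) (sum-cong-≗ {n} (pair-classified i)))) ⟩
    ∑[ i < n ] ∑[ j < n ] [ not (i =ᵇ j) ]
      ≡⟨ sum-cong-≗ {n} (λ i → cong (_∸ 1) (sym (trans (sym (card-full n)) (card-∖ full i refl)))) ⟩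
    ∑[ i < n ] (n ∸ 1)
      ≡⟨ ∑-const n (n ∸ 1) ⟩
    n * (n ∸ 1) ∎
    where
    open ≡-Reasoning
    E : ℕ
    E = ∑[ i < n ] ∑[ j < n ] edge i j

  coDeg-dominating : ∀ U v → (∀ i → coAdj v i ≡ false) → coDeg U v ≡ 0
  coDeg-dominating U v dominating =
    trans (sum-cong-≗ (λ i → trans (cong (λ c → [ U i ∧ c ]) (dominating i)) (cong [_] (∧-zeroʳ (U i)))))
          (sum-replicate-zero n)

  indepIn-remove-dominating : ∀ j U v → U v ≡ true → (∀ i → coAdj v i ≡ false) →
    indepIn (suc (suc j)) U ≡ indepIn (suc (suc j)) (U ∖ v)
  indepIn-remove-dominating j U v Uv dominating = begin
    indepIn (suc (suc j)) U
      ≡⟨ indepIn-remove (suc j) U v Uv (λ {i} c → ⊥-elim (true≢false (trans (sym (proj₂ (∧-elim (U i) c))) (dominating i)))) ⟩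
    binom (coDeg U v) (suc j) + indepIn (suc (suc j)) (U ∖ v)
      ≡⟨ cong (λ d → binom d (suc j) + indepIn (suc (suc j)) (U ∖ v)) (coDeg-dominating U v dominating) ⟩
    indepIn (suc (suc j)) (U ∖ v) ∎
    where open ≡-Reasoning

  coDegSum-remove-dominating : ∀ U v → U v ≡ true → (∀ i → coAdj v i ≡ false) → coDegSum U ≡ coDegSum (U ∖ v)
  coDegSum-remove-dominating U v Uv dominating =
    trans (coDegSum-remove U v Uv) (trans (cong (λ d → coDegSum (U ∖ v) + 2 * d) (coDeg-dominating U v dominating)) (+-identityʳ _))

  tri-minCoDeg-≤ : ∀ U v N → U v ≡ true → (∀ i → U i ≡ true → coDeg U v ≤ coDeg U i) → coDegSum U ≡ 2 * N →
    tri (suc (coDeg U v)) ≤ N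
  tri-minCoDeg-≤ U v N Uv minimal coDegSum≡ = *-cancelˡ-≤ 2 (begin
    2 * tri (suc x)         ≡⟨ 2*tri-suc x ⟩
    suc x * x               ≤⟨ *-monoˡ-≤ x (s≤s (coDeg-≤-card U v)) ⟩
    suc (card (U ∖ v)) * x  ≡⟨ cong (_* x) (card-∖ U v Uv) ⟨
    card U * x              ≤⟨ card*≤coDegSum U x minimal ⟩
    coDegSum U              ≡⟨ coDegSum≡ ⟩
    2 * N                   ∎)
    where
    open ≤-Reasoning
    x : ℕ
    x = coDeg U v

  indepIn-≤-cascadeBound : ∀ j u U s q → card U ≡ u → coDegSum U ≡ 2 * (tri s + q) → q < s →
    indepIn (suc (suc j)) U ≤ cascadeBound j s q
  indepIn-≤-cascadeBound j zero U s q card≡0 _ _ =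
    ≤-trans (≤-reflexive (trans (indepIn-independent _ U empty-indep) (cong (λ c → binom c (suc (suc j))) card≡0))) z≤n
    where
    empty-indep : IndependentSet U
    empty-indep Ui _ = ⊥-elim (true≢false (trans (sym Ui) (card-≡0 U card≡0 _)))
  indepIn-≤-cascadeBound j (suc u) U s q card≡ coDegSum≡ q<s with argmin U (coDeg U)
  ... | inj₂ none = ⊥-elim (0≢1+n (trans (sym (trans (sum-cong-≗ (λ i → cong [_] (none i))) (sum-replicate-zero n))) card≡))
  ... | inj₁ (v , Uv , minimal) with cascade-step j (coDeg U v) s q q<s (tri-minCoDeg-≤ U v (tri s + q) Uv minimal coDegSum≡)
  ... | s′ , q′ , N′+x≡N , q′<s′ , drop = begin
    indepIn (suc (suc j)) U                              ≤⟨ indepIn-remove-≤ (suc j) U v ⟩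
    binom x (suc j) + indepIn (suc (suc j)) (U ∖ v)      ≤⟨ +-monoʳ-≤ (binom x (suc j)) ih ⟩
    binom x (suc j) + cascadeBound j s′ q′               ≤⟨ drop ⟩
    cascadeBound j s q                                   ∎
    where
    open ≤-Reasoning
    x : ℕ
    x = coDeg U v
    coDegSum∖ : coDegSum (U ∖ v) ≡ 2 * (tri s′ + q′)
    coDegSum∖ = +-cancelʳ-≡ (2 * x) _ _ (begin-equality
      coDegSum (U ∖ v) + 2 * x        ≡⟨ coDegSum-remove U v Uv ⟨
      coDegSum U                      ≡⟨ coDegSum≡ ⟩
      2 * (tri s + q)                 ≡⟨ cong (2 *_) N′+x≡N ⟨
      2 * (tri s′ + q′ + x)           ≡⟨ *-distribˡ-+ 2 (tri s′ + q′) x ⟩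
      2 * (tri s′ + q′) + 2 * x       ∎)
    ih : indepIn (suc (suc j)) (U ∖ v) ≤ cascadeBound j s′ q′
    ih = indepIn-≤-cascadeBound j u (U ∖ v) s′ q′ (suc-injective (trans (sym (card-∖ U v Uv)) card≡)) coDegSum∖ q′<s′

indepCount-≤-cascadeBound : ∀ {n} (G : Graph n) j s q → q < s → 2 * edges G + 2 * (tri s + q) ≡ n * (n ∸ 1) →
  indepCount G (suc (suc j)) ≤ cascadeBound j s q
indepCount-≤-cascadeBound {n} G j s q q<s edges+N = begin
  indepCount G (suc (suc j))        ≡⟨ indepCount≡indepIn (suc (suc j)) ⟩
  indepIn (suc (suc j)) full        ≤⟨ indepIn-≤-cascadeBound j n full s q (card-full n) coDegSum≡ q<s ⟩
  cascadeBound j s q                ∎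
  where
  open GraphCounting G
  open ≤-Reasoning
  coDegSum≡ : coDegSum full ≡ 2 * (tri s + q)
  coDegSum≡ = +-cancelˡ-≡ (2 * edges G) _ _ (trans edges-coDegSum (sym edges+N))

atLeast : ∀ {n} → ℕ → Fin n → Bool
atLeast t i = not (toℕ i <ᵇ t)

card-atLeast : ∀ n t → card {n} (atLeast t) ≡ n ∸ t
card-atLeast zero    t       = sym (0∸n≡0 t)
card-atLeast (suc n) zero    = cong suc (card-atLeast n zero)
card-atLeast (suc n) (suc t) = card-atLeast n t

atLeast-∖ : ∀ {n} t (v : Fin n) → toℕ v ≡ t → ∀ i → (atLeast t ∖ v) i ≡ atLeast (suc t) i
atLeast-∖ t v refl i = go t (toℕ i)
  where
  go : ∀ t x → not (x <ᵇ t) ∧ not (t == x) ≡ not (x <ᵇ suc t)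
  go zero    zero    = refl
  go zero    (suc x) = refl
  go (suc t) zero    = refl
  go (suc t) (suc x) = go t x

-- Vertices 0,…,a−1 are joined to everything, vertex a to the p vertices a+1,…,a+p, and the
-- last s = p + q vertices are pairwise non-adjacent.
module Extremal (a p q : ℕ) where
  s : ℕ
  s = p + q

  n : ℕ
  n = suc a + s

  dominates : ℕ → ℕ → Bool
  dominates x y = (x <ᵇ a) ∨ ((x == a) ∧ (y <ᵇ suc (a + p)))

  joined : ℕ → ℕ → Bool
  joined x y = not (x == y) ∧ (dominates x y ∨ dominates y x)

  graph : Graph n
  graph = record
    { adj    = λ i j → joined (toℕ i) (toℕ j)
    ; sym    = λ i j → cong₂ (λ e d → not e ∧ d) (==-sym (toℕ i) (toℕ j)) (∨-comm (dominates (toℕ i) (toℕ j)) _)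
    ; irrefl = λ i → cong (λ e → not e ∧ (dominates (toℕ i) (toℕ i) ∨ dominates (toℕ i) (toℕ i))) (==-refl (toℕ i))
    }

  open GraphCounting graph

  joined-above : ∀ x y → a < x → a < y → joined x y ≡ false
  joined-above x y a<x a<y
    rewrite ≥⇒<ᵇ≡false (<⇒≤ a<x) | ≥⇒<ᵇ≡false (<⇒≤ a<y) | ≢⇒==-false (≢-sym (<⇒≢ a<x)) | ≢⇒==-false (≢-sym (<⇒≢ a<y))
    = ∧-zeroʳ (not (x == y))

  above : ∀ t {i : Fin n} → a ≤ t → atLeast (suc t) i ≡ true → a < toℕ i
  above t {i} a≤t i≥t = ≤-trans (s≤s a≤t) (<ᵇ≡false⇒≥ (toℕ i) (suc t) (not-true i≥t))
    where
    not-true : ∀ {b} → not b ≡ true → b ≡ false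
    not-true {false} _ = refl

  universal : ∀ (v : Fin n) → toℕ v < a → ∀ i → coAdj v i ≡ false
  universal v v<a i rewrite <⇒<ᵇ≡true v<a = go (toℕ v == toℕ i)
    where
    go : ∀ e → not e ∧ not (not e ∧ true) ≡ false
    go true  = refl
    go false = refl

  apex-row : ∀ y → not (y <ᵇ a) ∧ (not (a == y) ∧ not (joined a y)) ≡ not (y <ᵇ suc (a + p))
  apex-row y with <-cmp y a
  ... | tri< y<a _ _ rewrite <⇒<ᵇ≡true y<a | <⇒<ᵇ≡true (≤-trans y<a (≤-trans (m≤m+n a p) (n≤1+n (a + p)))) = refl
  ... | tri≈ _ refl _ rewrite ==-refl y | <⇒<ᵇ≡true (s≤s (m≤m+n y p)) | ≥⇒<ᵇ≡false (≤-refl {y}) = refl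
  ... | tri> _ _ a<y
    rewrite ≥⇒<ᵇ≡false (<⇒≤ a<y) | ≢⇒==-false (<⇒≢ a<y) | ≢⇒==-false (≢-sym (<⇒≢ a<y)) | ≥⇒<ᵇ≡false (≤-refl {a}) | ==-refl a
    = go (y <ᵇ suc (a + p))
    where
    go : ∀ b → true ∧ (true ∧ not (true ∧ (b ∨ false))) ≡ not b
    go true  = refl
    go false = refl

  apex-coNbrs : ∀ (v : Fin n) → toℕ v ≡ a → ∀ i → atLeast a i ∧ coAdj v i ≡ atLeast (suc (a + p)) i
  apex-coNbrs v toℕv≡a i =
    subst (λ x → not (toℕ i <ᵇ a) ∧ (not (x == toℕ i) ∧ not (joined x (toℕ i))) ≡ not (toℕ i <ᵇ suc (a + p)))
          (sym toℕv≡a) (apex-row (toℕ i))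

  peel-universal : (F : (Fin n → Bool) → ℕ) →
    (∀ U v → U v ≡ true → (∀ i → coAdj v i ≡ false) → F U ≡ F (U ∖ v)) →
    (∀ {U V} → (∀ i → U i ≡ V i) → F U ≡ F V) →
    F full ≡ F (atLeast a)
  peel-universal F remove-dominating F-≗ = peel a 0 refl
    where
    peel : ∀ d t → t + d ≡ a → F (atLeast t) ≡ F (atLeast a)
    peel zero    t t+0≡a = cong (λ t → F (atLeast t)) (trans (sym (+-identityʳ t)) t+0≡a)
    peel (suc d) t t+d≡a = begin
      F (atLeast t)      ≡⟨ remove-dominating (atLeast t) v (cong not (≥⇒<ᵇ≡false (≤-reflexive (sym toℕv≡t))))
                                                           (universal v (subst (_< a) (sym toℕv≡t) t<a)) ⟩
      F (atLeast t ∖ v)  ≡⟨ F-≗ (atLeast-∖ t v toℕv≡t) ⟩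
      F (atLeast (suc t)) ≡⟨ peel d (suc t) (trans (sym (+-suc t d)) t+d≡a) ⟩
      F (atLeast a)      ∎
      where
      open ≡-Reasoning
      t<a : t < a
      t<a = subst (t <_) t+d≡a (≤-trans (s≤s (m≤m+n t d)) (≤-reflexive (sym (+-suc t d))))
      t<n : t < n
      t<n = ≤-trans t<a (≤-trans (n≤1+n a) (m≤m+n (suc a) s))
      v : Fin n
      v = fromℕ< t<n
      toℕv≡t : toℕ v ≡ t
      toℕv≡t = toℕ-fromℕ< t<n

  private
    a<n : a < n
    a<n = s≤s (m≤m+n a s)

    apex : Fin n
    apex = fromℕ< a<n

    toℕ-apex : toℕ apex ≡ a
    toℕ-apex = toℕ-fromℕ< a<n

    apex∈ : atLeast a apex ≡ true
    apex∈ = cong not (≥⇒<ᵇ≡false (≤-reflexive (sym toℕ-apex)))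

    independent-above : ∀ t → a ≤ t → IndependentSet (atLeast (suc t))
    independent-above t a≤t i∈ j∈ = joined-above _ _ (above t a≤t i∈) (above t a≤t j∈)

    apex-coNbrs-indep : IndependentSet (λ i → atLeast a i ∧ coAdj apex i)
    apex-coNbrs-indep {i} {j} ci cj = independent-above (a + p) (m≤m+n a p)
      (trans (sym (apex-coNbrs apex toℕ-apex i)) ci) (trans (sym (apex-coNbrs apex toℕ-apex j)) cj)

    coDeg-apex : coDeg (atLeast a) apex ≡ q
    coDeg-apex = begin
      coDeg (atLeast a) apex                  ≡⟨ sum-cong-≗ (λ i → cong [_] (apex-coNbrs apex toℕ-apex i)) ⟩
      card {n} (atLeast (suc (a + p)))        ≡⟨ card-atLeast n (suc (a + p)) ⟩
      suc a + (p + q) ∸ suc (a + p)           ≡⟨ cong (_∸ suc (a + p)) (+-assoc (suc a) p q) ⟨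
      suc a + p + q ∸ suc (a + p)             ≡⟨ m+n∸m≡n (suc (a + p)) q ⟩
      q                                       ∎
      where open ≡-Reasoning

    rest : ∀ i → (atLeast a ∖ apex) i ≡ atLeast (suc a) i
    rest = atLeast-∖ a apex toℕ-apex

    card-rest : card {n} (atLeast (suc a)) ≡ s
    card-rest = trans (card-atLeast n (suc a)) (m+n∸m≡n (suc a) s)

  indepCount-graph : ∀ j → indepCount graph (suc (suc j)) ≡ cascadeBound j s q
  indepCount-graph j = begin
    indepCount graph (suc (suc j))
      ≡⟨ indepCount≡indepIn (suc (suc j)) ⟩
    indepIn (suc (suc j)) full
      ≡⟨ peel-universal (indepIn (suc (suc j))) (indepIn-remove-dominating j) (indepIn-≗ (suc (suc j))) ⟩
    indepIn (suc (suc j)) (atLeast a)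
      ≡⟨ indepIn-remove (suc j) (atLeast a) apex apex∈ apex-coNbrs-indep ⟩
    binom (coDeg (atLeast a) apex) (suc j) + indepIn (suc (suc j)) (atLeast a ∖ apex)
      ≡⟨ cong₂ (λ d i → binom d (suc j) + i) coDeg-apex (indepIn-≗ (suc (suc j)) rest) ⟩
    binom q (suc j) + indepIn (suc (suc j)) (atLeast (suc a))
      ≡⟨ cong (binom q (suc j) +_) (trans (indepIn-independent _ _ (independent-above a ≤-refl)) (cong (λ c → binom c (suc (suc j))) card-rest)) ⟩
    cascadeBound j s q ∎
    where open ≡-Reasoning

  edges-graph : 2 * edges graph + 2 * (tri s + q) ≡ n * (n ∸ 1)
  edges-graph = trans (cong (2 * edges graph +_) coDegSum-full) edges-coDegSum
    where
    open ≡-Reasoning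
    coDegSum-full : 2 * (tri s + q) ≡ coDegSum full
    coDegSum-full = sym (begin
      coDegSum full                               ≡⟨ peel-universal coDegSum coDegSum-remove-dominating coDegSum-≗ ⟩
      coDegSum (atLeast a)                        ≡⟨ coDegSum-remove (atLeast a) apex apex∈ ⟩
      coDegSum (atLeast a ∖ apex) + 2 * coDeg (atLeast a) apex
        ≡⟨ cong₂ (λ c d → c + 2 * d) (trans (coDegSum-≗ rest) (coDegSum-independent _ (independent-above a ≤-refl))) coDeg-apex ⟩
      card {n} (atLeast (suc a)) * (card {n} (atLeast (suc a)) ∸ 1) + 2 * q
        ≡⟨ cong (λ c → c * (c ∸ 1) + 2 * q) card-rest ⟩
      s * (s ∸ 1) + 2 * q                         ≡⟨ cong (_+ 2 * q) (2*tri s) ⟨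
      2 * tri s + 2 * q                           ≡⟨ *-distribˡ-+ 2 (tri s) q ⟨
      2 * (tri s + q)                             ∎)

2n∸k≡k+2s : ∀ a s → 2 * (suc a + s) ∸ suc a ≡ suc a + 2 * s
2n∸k≡k+2s a s = trans (cong (_∸ suc a) (double a s)) (m+n∸m≡n (suc a) (suc a + 2 * s))
  where
  double : ∀ a s → 2 * (suc a + s) ≡ suc a + (suc a + 2 * s)
  double = solve-∀

2n∸a∸1≡k+2s : ∀ a s → 2 * (suc a + s) ∸ a ∸ 1 ≡ suc a + 2 * s
2n∸a∸1≡k+2s a s = cong (_∸ 1) (trans (cong (_∸ a) (double a s)) (m+n∸m≡n a (suc (suc a + 2 * s))))
  where
  double : ∀ a s → 2 * (suc a + s) ≡ a + suc (suc a + 2 * s)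
  double = solve-∀

p≤n∸k : ∀ a s m p → 2 * p + a * (suc a + 2 * s) ≡ 2 * m → 2 * m ≤ suc a * (a + 2 * s) → p ≤ s
p≤n∸k a s m p p-def m≤ = *-cancelˡ-≤ 2 (+-cancelʳ-≤ (a * (suc a + 2 * s)) (2 * p) (2 * s) (begin
  2 * p + a * (suc a + 2 * s)   ≡⟨ p-def ⟩
  2 * m                         ≤⟨ m≤ ⟩
  suc a * (a + 2 * s)           ≡⟨ expand a s ⟩
  2 * s + a * (suc a + 2 * s)   ∎))
  where
  open ≤-Reasoning
  expand : ∀ a s → suc a * (a + 2 * s) ≡ 2 * s + a * (suc a + 2 * s)
  expand = solve-∀

-- p = 0 would make k − 1 satisfy the defining inequality of k (or m = 0 when k = 1).
p-positive : ∀ a s m p → 1 ≤ m → 2 * p + a * (suc a + 2 * s) ≡ 2 * m → (1 ≤ a → a * (suc a + 2 * s) < 2 * m) → 1 ≤ p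
p-positive a       s m (suc p) _   _     _         = s≤s z≤n
p-positive zero    s m zero    1≤m p-def _         = ⊥-elim (<-irrefl p-def (≤-trans (s≤s z≤n) (*-monoʳ-≤ 2 1≤m)))
p-positive (suc a) s m zero    _   p-def k-1-fails = ⊥-elim (<-irrefl p-def (k-1-fails (s≤s z≤n)))

cascade-of-non-edges : ∀ a p q m → 2 * suc p + a * (suc a + 2 * (suc p + q)) ≡ 2 * m →
  2 * m + 2 * (tri (suc p + q) + q) ≡ (suc a + (suc p + q)) * (a + (suc p + q))
cascade-of-non-edges a p q m p-def = begin
  2 * m + 2 * (tri (suc p + q) + q)                  ≡⟨ cong₂ _+_ (sym p-def) (*-distribˡ-+ 2 (tri (suc p + q)) q) ⟩
  2 * suc p + a * (suc a + 2 * (suc p + q)) + (2 * tri (suc (p + q)) + 2 * q)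
    ≡⟨ cong (λ t → 2 * suc p + a * (suc a + 2 * (suc p + q)) + (t + 2 * q)) (2*tri-suc (p + q)) ⟩
  2 * suc p + a * (suc a + 2 * (suc p + q)) + (suc (p + q) * (p + q) + 2 * q)
    ≡⟨ identity a p q ⟩
  (suc a + (suc p + q)) * (a + (suc p + q))           ∎
  where
  open ≡-Reasoning
  identity : ∀ a p q → 2 * suc p + a * (suc a + 2 * (suc p + q)) + (suc (p + q) * (p + q) + 2 * q)
                       ≡ (suc a + (suc p + q)) * (a + (suc p + q))
  identity = solve-∀

choice-of-k : ∀ n m k p → 1 ≤ m → 1 ≤ k → k ≤ n ∸ 1 → 2 * m ≤ k * (2 * n ∸ k ∸ 1) →
  (∀ k′ → 1 ≤ k′ → k′ < k → k′ * (2 * n ∸ k′ ∸ 1) < 2 * m) →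
  2 * p + (k ∸ 1) * (2 * n ∸ k) ≡ 2 * m →
  Σ ℕ λ a → Σ ℕ λ q → k ≡ suc a × n ≡ suc a + (p + q) × q < p + q × 2 * m + 2 * (tri (p + q) + q) ≡ n * (n ∸ 1)
choice-of-k n m (suc a) p 1≤m _ k≤n∸1 m≤ minimal p-def with m≤n⇒∃[o]m+o≡n (≤-trans k≤n∸1 (m∸n≤m n 1))
... | s , refl with m≤n⇒∃[o]m+o≡n (p≤n∸k a s m p p-def′ m≤′) | p-positive a s m p 1≤m p-def′ k-1-fails
  where
  p-def′ : 2 * p + a * (suc a + 2 * s) ≡ 2 * m
  p-def′ = subst (λ t → 2 * p + a * t ≡ 2 * m) (2n∸k≡k+2s a s) p-def
  m≤′ : 2 * m ≤ suc a * (a + 2 * s)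
  m≤′ = subst (λ t → 2 * m ≤ suc a * (t ∸ 1)) (2n∸k≡k+2s a s) m≤
  k-1-fails : 1 ≤ a → a * (suc a + 2 * s) < 2 * m
  k-1-fails 1≤a = subst (λ t → a * t < 2 * m) (2n∸a∸1≡k+2s a s) (minimal a 1≤a ≤-refl)
... | q , refl | s≤s z≤n = a , q , refl , refl , +-monoˡ-< q (s≤s z≤n) ,
  cascade-of-non-edges a _ q m (subst (λ t → 2 * p + a * t ≡ 2 * m) (2n∸k≡k+2s a (p + q)) p-def)

cascadeBound≡binomials : ∀ a p q j →
  cascadeBound j (p + q) q ≡ ((suc a + (p + q) ∸ suc a ∸ p) C suc j) + ((suc a + (p + q) ∸ suc a) C suc (suc j))
cascadeBound≡binomials a p q j rewrite m+n∸m≡n (suc a) (p + q) | m+n∸m≡n p q =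
  cong₂ _+_ (binom≡C q (suc j)) (binom≡C (p + q) (suc (suc j)))

corollary1 : (n m r k p : ℕ) →
    2 ≤ n → 1 ≤ m → 2 * m ≤ n * (n ∸ 1) → 2 < r →
    -- k is the smallest element of {1,…,n-1} with m ≤ k(2n-k-1)/2
    1 ≤ k → k ≤ n ∸ 1 → 2 * m ≤ k * (2 * n ∸ k ∸ 1) →
    (∀ k′ → 1 ≤ k′ → k′ < k → k′ * (2 * n ∸ k′ ∸ 1) < 2 * m) →
    -- p = p_k = m - (k-1)(2n-k)/2
    2 * p + (k ∸ 1) * (2 * n ∸ k) ≡ 2 * m →
    ((G : Graph n) → edges G ≡ m →
      indepCount G r ≤ ((n ∸ k ∸ p) C (r ∸ 1)) + ((n ∸ k) C r))
    × Σ (Graph n) (λ G → edges G ≡ m ×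
      indepCount G r ≡ ((n ∸ k ∸ p) C (r ∸ 1)) + ((n ∸ k) C r))
corollary1 n m (suc (suc (suc j))) k p _ 1≤m _ (s≤s (s≤s (s≤s _))) 1≤k k≤n∸1 m≤ minimal p-def
  with choice-of-k n m k p 1≤m 1≤k k≤n∸1 m≤ minimal p-def
... | a , q , refl , refl , q<s , non-edges = bound , Extremal.graph a p q , edges≡m , attained
  where
  binomials : ℕ
  binomials = ((suc a + (p + q) ∸ suc a ∸ p) C suc (suc j)) + ((suc a + (p + q) ∸ suc a) C suc (suc (suc j)))
  bound : (G : Graph (suc a + (p + q))) → edges G ≡ m → indepCount G (suc (suc (suc j))) ≤ binomials
  bound G refl = subst (indepCount G (suc (suc (suc j))) ≤_) (cascadeBound≡binomials a p q (suc j))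
    (indepCount-≤-cascadeBound G (suc j) (p + q) q q<s non-edges)
  edges≡m : edges (Extremal.graph a p q) ≡ m
  edges≡m = *-cancelˡ-≡ _ _ 2 (+-cancelʳ-≡ (2 * (tri (p + q) + q)) _ _
    (trans (Extremal.edges-graph a p q) (sym non-edges)))
  attained : indepCount (Extremal.graph a p q) (suc (suc (suc j))) ≡ binomials
  attained = trans (Extremal.indepCount-graph a p q (suc j)) (cascadeBound≡binomials a p q (suc j))
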